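{- For $j\ge0$ and $t\ge1$ let $c_{2j+1}(t)$ be the coefficient of $x^{j+t}$ in $(1+x)^{2t}(1-x^{2j+1})$, and for $j\ge1$, $t\ge0$ let $c_{2j}(t)$ be the coefficient of $x^{j+t}$ in $(1+x)^{2t+1}(1-x^{2j})$. Let $C_t=\frac{1}{t+1}\binom{2t}{t}$ denote the Catalan numbers. (a) If $m=2m'+1$ with $m'\ge0$, then for $t\ge1$, $$c_{m+1}(t)=\sum_{i=0}^{m'}(-1)^i\,c_{m-2i}(t+1).$$ (b) If $m=2m'$ with $m'\ge1$, then for $t\ge1$, $$c_{m+1}(t)=(-1)^{m'}C_t+\sum_{i=0}^{m'-1}(-1)^i\,c_{m-2i}(t).$$ -}

module Defs where

open import Data.Nat as ℕ using (ℕ; zero; suc; _∸_; ⌊_/2⌋)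
open import Data.Nat.Combinatorics using (_C_)
open import Data.Integer as ℤ using (ℤ; +_; -_)
open import Data.List using (List; []; _∷_; map; replicate; _++_; upTo; foldr)
open import Data.Bool using (Bool; true; false; if_then_else_)

-- Polynomials with integer coefficients, as coefficient lists
-- (lowest degree first).
Poly : Set
Poly = List ℤ

infixl 6 _⊕_
infixl 7 _⊛_

_⊕_ : Poly → Poly → Poly
[]      ⊕ q       = q
(a ∷ p) ⊕ []      = a ∷ p
(a ∷ p) ⊕ (b ∷ q) = (a ℤ.+ b) ∷ (p ⊕ q)

_⊛_ : Poly → Poly → Poly
[]      ⊛ q = []
(a ∷ p) ⊛ q = map (a ℤ.*_) q ⊕ (+ 0 ∷ (p ⊛ q))

polyPow : Poly → ℕ → Poly
polyPow p zero    = + 1 ∷ []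
polyPow p (suc n) = p ⊛ polyPow p n

coeff : Poly → ℕ → ℤ
coeff []      _       = + 0
coeff (a ∷ p) zero    = a
coeff (a ∷ p) (suc k) = coeff p k

onePlusX : Poly
onePlusX = + 1 ∷ + 1 ∷ []

monomial : ℕ → Poly
monomial d = replicate d (+ 0) ++ (+ 1 ∷ [])

oneMinusXPow : ℕ → Poly
oneMinusXPow d = (+ 1 ∷ []) ⊕ map -_ (monomial d)

cOdd : ℕ → ℕ → ℤ
cOdd j t = coeff (polyPow onePlusX (2 ℕ.* t) ⊛ oneMinusXPow (2 ℕ.* j ℕ.+ 1)) (j ℕ.+ t)

cEven : ℕ → ℕ → ℤ
cEven j t = coeff (polyPow onePlusX (2 ℕ.* t ℕ.+ 1) ⊛ oneMinusXPow (2 ℕ.* j)) (j ℕ.+ t)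

isOdd : ℕ → Bool
isOdd zero          = false
isOdd (suc zero)    = true
isOdd (suc (suc n)) = isOdd n

c : ℕ → ℕ → ℤ
c m t = if isOdd m then cOdd ⌊ m /2⌋ t else cEven ⌊ m /2⌋ t

sgn : ℕ → ℤ
sgn i = (- (+ 1)) ℤ.^ i

Σ< : ℕ → (ℕ → ℤ) → ℤ
Σ< n f = foldr ℤ._+_ (+ 0) (map f (upTo n))

catalan : ℕ → ℕ
catalan t = ((2 ℕ.* t) C t) ℕ./ suc t

{-# OPTIONS --safe #-}
module Submission where

-- With b(N,k) = C(N,k) − C(N,k+1) (ballot below), the coefficient of the middle power x^k of
-- (1+x)^N (1 − x^d), when N + d = 2k + 1, is b(N,k): so c_{2j+1}(t) = b(2t, j+t) and
-- c_{2j}(t) = b(2t+1, j+t). Pascal's rule b(N+1,k+1) = b(N,k+1) + b(N,k) then reads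
-- c_{2j+1}(t+1) = c_{2j+2}(t) + c_{2j}(t) and c_{2j+2}(t) = c_{2j+3}(t) + c_{2j+1}(t),
-- so both alternating sums telescope, down to c_0(t) = b(2t+1,t) = 0 in (a) and to
-- c_1(t) = b(2t,t) = C_t in (b).

open import Defs
open import Data.Nat as ℕ using (ℕ; zero; suc; _≤_; _<_; _∸_; z≤n; s≤s; _≤?_; ⌊_/2⌋)
open import Data.Nat.Combinatorics
  using (_C_; nCk+nC[k+1]≡[n+1]C[k+1]; nCk≡nC[n∸k]; k>n⇒nCk≡0; nC1≡n)
open import Data.Nat.DivMod using (_/_; m*n/n≡m)
import Data.Nat.Properties as ℕP
import Data.Nat.Tactic.RingSolver as ℕSolver
open import Data.Integer as ℤ using (ℤ; +_; -_; _+_; _-_; _*_)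
import Data.Integer.Properties as ℤP
open import Data.Integer.Tactic.RingSolver using (solve-∀)
open import Data.List using ([]; _∷_; map; foldr)
open import Data.List.Properties using (map-upTo)
open import Data.Bool using (true; false)
open import Data.Product using (_×_; _,_)
open import Function using (_∘_)
open import Relation.Nullary using (yes; no)
open import Relation.Binary.PropositionalEquality
  using (_≡_; refl; sym; trans; cong; cong₂; subst; module ≡-Reasoning)

coeff-⊕ : ∀ p q k → coeff (p ⊕ q) k ≡ coeff p k + coeff q k
coeff-⊕ []      q       k       = sym (ℤP.+-identityˡ _)
coeff-⊕ (a ∷ p) []      k       = sym (ℤP.+-identityʳ _)
coeff-⊕ (a ∷ p) (b ∷ q) zero    = refl
coeff-⊕ (a ∷ p) (b ∷ q) (suc k) = coeff-⊕ p q k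

coeff-map : ∀ (f : ℤ → ℤ) → f (+ 0) ≡ + 0 → ∀ p k → coeff (map f p) k ≡ f (coeff p k)
coeff-map f f0≡0 []      k       = sym f0≡0
coeff-map f f0≡0 (a ∷ p) zero    = refl
coeff-map f f0≡0 (a ∷ p) (suc k) = coeff-map f f0≡0 p k

coeff-∷-⊛ : ∀ a p q k → coeff ((a ∷ p) ⊛ q) k ≡ a * coeff q k + coeff (+ 0 ∷ p ⊛ q) k
coeff-∷-⊛ a p q k =
  trans (coeff-⊕ (map (a *_) q) _ k) (cong (_+ _) (coeff-map (a *_) (ℤP.*-zeroʳ a) q k))

coeff-⊛-sub : ∀ p q r k → coeff (p ⊛ (q ⊕ map -_ r)) k ≡ coeff (p ⊛ q) k - coeff (p ⊛ r) k
coeff-⊛-sub []      q r k = refl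
coeff-⊛-sub (a ∷ p) q r k = begin
  coeff ((a ∷ p) ⊛ (q ⊕ map -_ r)) k
    ≡⟨ coeff-∷-⊛ a p _ k ⟩
  a * coeff (q ⊕ map -_ r) k + coeff (+ 0 ∷ p ⊛ (q ⊕ map -_ r)) k
    ≡⟨ cong₂ (λ x y → a * x + y) head (tail k) ⟩
  a * (coeff q k - coeff r k) + (coeff (+ 0 ∷ p ⊛ q) k - coeff (+ 0 ∷ p ⊛ r) k)
    ≡⟨ distrib a (coeff q k) (coeff r k) _ _ ⟩
  (a * coeff q k + coeff (+ 0 ∷ p ⊛ q) k) - (a * coeff r k + coeff (+ 0 ∷ p ⊛ r) k)
    ≡⟨ sym (cong₂ _-_ (coeff-∷-⊛ a p q k) (coeff-∷-⊛ a p r k)) ⟩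
  coeff ((a ∷ p) ⊛ q) k - coeff ((a ∷ p) ⊛ r) k
    ∎
  where
  open ≡-Reasoning
  head : coeff (q ⊕ map -_ r) k ≡ coeff q k - coeff r k
  head = trans (coeff-⊕ q _ k) (cong (λ x → coeff q k + x) (coeff-map -_ refl r k))
  tail : ∀ k → coeff (+ 0 ∷ p ⊛ (q ⊕ map -_ r)) k ≡ coeff (+ 0 ∷ p ⊛ q) k - coeff (+ 0 ∷ p ⊛ r) k
  tail zero    = refl
  tail (suc k) = coeff-⊛-sub p q r k
  distrib : ∀ a x y u v → a * (x - y) + (u - v) ≡ (a * x + u) - (a * y + v)
  distrib = solve-∀

coeff-⊛-one : ∀ p k → coeff (p ⊛ (+ 1 ∷ [])) k ≡ coeff p k
coeff-⊛-one []      k       = refl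
coeff-⊛-one (a ∷ p) zero    =
  trans (coeff-∷-⊛ a p (+ 1 ∷ []) zero) (trans (ℤP.+-identityʳ _) (ℤP.*-identityʳ a))
coeff-⊛-one (a ∷ p) (suc k) = trans (coeff-∷-⊛ a p (+ 1 ∷ []) (suc k))
  (trans (cong (_+ coeff (p ⊛ (+ 1 ∷ [])) k) (ℤP.*-zeroʳ a))
         (trans (ℤP.+-identityˡ _) (coeff-⊛-one p k)))

coeff-⊛-shift : ∀ p q k → coeff (p ⊛ (+ 0 ∷ q)) k ≡ coeff (+ 0 ∷ p ⊛ q) k
coeff-⊛-shift []      q zero    = refl
coeff-⊛-shift []      q (suc k) = refl
coeff-⊛-shift (a ∷ p) q zero    = trans (coeff-∷-⊛ a p (+ 0 ∷ q) zero) (cong (_+ + 0) (ℤP.*-zeroʳ a))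
coeff-⊛-shift (a ∷ p) q (suc k) = trans (coeff-∷-⊛ a p (+ 0 ∷ q) (suc k))
  (trans (cong (λ x → a * coeff q k + x) (coeff-⊛-shift p q k)) (sym (coeff-∷-⊛ a p q k)))

coeff-⊛-monomial : ∀ p d k → coeff (p ⊛ monomial d) (d ℕ.+ k) ≡ coeff p k
coeff-⊛-monomial p zero    k = coeff-⊛-one p k
coeff-⊛-monomial p (suc d) k =
  trans (coeff-⊛-shift p (monomial d) (suc (d ℕ.+ k))) (coeff-⊛-monomial p d k)

coeff-⊛-monomial-< : ∀ p d k → k < d → coeff (p ⊛ monomial d) k ≡ + 0
coeff-⊛-monomial-< p (suc d) zero    _         = coeff-⊛-shift p (monomial d) zero
coeff-⊛-monomial-< p (suc d) (suc k) (s≤s k<d) =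
  trans (coeff-⊛-shift p (monomial d) (suc k)) (coeff-⊛-monomial-< p d k k<d)

coeff-one-⊛ : ∀ q k → coeff ((+ 1 ∷ []) ⊛ q) k ≡ coeff q k
coeff-one-⊛ q k = trans (coeff-∷-⊛ (+ 1) [] q k)
  (trans (cong₂ _+_ (ℤP.*-identityˡ (coeff q k)) (coeff-zero k)) (ℤP.+-identityʳ (coeff q k)))
  where
  coeff-zero : ∀ k → coeff (+ 0 ∷ []) k ≡ + 0
  coeff-zero zero    = refl
  coeff-zero (suc k) = refl

binomial : ℕ → Poly
binomial n = polyPow onePlusX n

coeff-binomial : ∀ n k → coeff (binomial n) k ≡ + (n C k)
coeff-binomial zero    zero    = refl
coeff-binomial zero    (suc k) = refl
coeff-binomial (suc n) zero    = begin
  coeff (binomial (suc n)) zero       ≡⟨ coeff-∷-⊛ (+ 1) (+ 1 ∷ []) (binomial n) zero ⟩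
  + 1 * coeff (binomial n) zero + + 0 ≡⟨ ℤP.+-identityʳ _ ⟩
  + 1 * coeff (binomial n) zero       ≡⟨ ℤP.*-identityˡ _ ⟩
  coeff (binomial n) zero             ≡⟨ coeff-binomial n zero ⟩
  + 1                                 ∎
  where open ≡-Reasoning
coeff-binomial (suc n) (suc k) = begin
  coeff (binomial (suc n)) (suc k)
    ≡⟨ coeff-∷-⊛ (+ 1) (+ 1 ∷ []) (binomial n) (suc k) ⟩
  + 1 * coeff (binomial n) (suc k) + coeff ((+ 1 ∷ []) ⊛ binomial n) k
    ≡⟨ cong₂ _+_ (ℤP.*-identityˡ (coeff (binomial n) (suc k))) (coeff-one-⊛ (binomial n) k) ⟩
  coeff (binomial n) (suc k) + coeff (binomial n) k
    ≡⟨ cong₂ _+_ (coeff-binomial n (suc k)) (coeff-binomial n k) ⟩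
  + (n C suc k ℕ.+ n C k)
    ≡⟨ cong +_ (trans (ℕP.+-comm (n C suc k) (n C k)) (nCk+nC[k+1]≡[n+1]C[k+1] n k)) ⟩
  + (suc n C suc k)
    ∎
  where open ≡-Reasoning

coeff-binomial-⊛-monomial : ∀ N d k → k ≤ N ℕ.+ d →
  coeff (binomial N ⊛ monomial d) k ≡ + (N C (N ℕ.+ d ∸ k))
coeff-binomial-⊛-monomial N d k k≤N+d with d ≤? k
... | yes d≤k = begin
  coeff (binomial N ⊛ monomial d) k
    ≡⟨ cong (coeff (binomial N ⊛ monomial d)) (sym (ℕP.m+[n∸m]≡n d≤k)) ⟩
  coeff (binomial N ⊛ monomial d) (d ℕ.+ (k ∸ d))
    ≡⟨ coeff-⊛-monomial (binomial N) d (k ∸ d) ⟩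
  coeff (binomial N) (k ∸ d)
    ≡⟨ coeff-binomial N (k ∸ d) ⟩
  + (N C (k ∸ d))
    ≡⟨ cong +_ (nCk≡nC[n∸k] k∸d≤N) ⟩
  + (N C (N ∸ (k ∸ d)))
    ≡⟨ cong (λ i → + (N C i)) complement ⟩
  + (N C (N ℕ.+ d ∸ k))
    ∎
  where
  open ≡-Reasoning
  k∸d≤N : k ∸ d ≤ N
  k∸d≤N = ℕP.m≤n+o⇒m∸n≤o k d (subst (k ≤_) (ℕP.+-comm N d) k≤N+d)
  complement : N ∸ (k ∸ d) ≡ N ℕ.+ d ∸ k
  complement = begin
    N ∸ (k ∸ d)               ≡⟨ sym (ℕP.[m+n]∸[m+o]≡n∸o d N (k ∸ d)) ⟩
    d ℕ.+ N ∸ (d ℕ.+ (k ∸ d)) ≡⟨ cong₂ _∸_ (ℕP.+-comm d N) (ℕP.m+[n∸m]≡n d≤k) ⟩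
    N ℕ.+ d ∸ k               ∎
... | no d≰k = trans (coeff-⊛-monomial-< (binomial N) d k k<d) (cong +_ (sym (k>n⇒nCk≡0 N<N+d∸k)))
  where
  k<d : k < d
  k<d = ℕP.≰⇒> d≰k
  N<N+d∸k : N < N ℕ.+ d ∸ k
  N<N+d∸k = subst (N <_) (sym (ℕP.+-∸-assoc N (ℕP.<⇒≤ k<d))) (ℕP.m<m+n N (ℕP.m<n⇒0<n∸m k<d))

ballot : ℕ → ℕ → ℤ
ballot n k = + (n C k) - + (n C suc k)

ballot-pascal : ∀ n k → ballot (suc n) (suc k) ≡ ballot n (suc k) + ballot n k
ballot-pascal n k = begin
  + (suc n C suc k) - + (suc n C suc (suc k))
    ≡⟨ cong₂ _-_ (pascal k) (pascal (suc k)) ⟩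
  (+ (n C k) + + (n C suc k)) - (+ (n C suc k) + + (n C suc (suc k)))
    ≡⟨ regroup (+ (n C k)) (+ (n C suc k)) (+ (n C suc (suc k))) ⟩
  ballot n (suc k) + ballot n k
    ∎
  where
  open ≡-Reasoning
  pascal : ∀ k → + (suc n C suc k) ≡ + (n C k) + + (n C suc k)
  pascal k = cong +_ (sym (nCk+nC[k+1]≡[n+1]C[k+1] n k))
  regroup : ∀ a b c → (a + b) - (b + c) ≡ (b - c) + (a - b)
  regroup = solve-∀

coeff-binomial-⊛-oneMinusXPow : ∀ N d k → N ℕ.+ d ≡ k ℕ.+ suc k →
  coeff (binomial N ⊛ oneMinusXPow d) k ≡ ballot N k
coeff-binomial-⊛-oneMinusXPow N d k N+d≡k+[1+k] =
  trans (coeff-⊛-sub (binomial N) (+ 1 ∷ []) (monomial d) k)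
    (cong₂ _-_ (trans (coeff-⊛-one (binomial N) k) (coeff-binomial N k))
               (trans (coeff-binomial-⊛-monomial N d k k≤N+d) (cong (λ i → + (N C i)) N+d∸k≡1+k)))
  where
  k≤N+d : k ≤ N ℕ.+ d
  k≤N+d = subst (k ≤_) (sym N+d≡k+[1+k]) (ℕP.m≤m+n k (suc k))
  N+d∸k≡1+k : N ℕ.+ d ∸ k ≡ suc k
  N+d∸k≡1+k = trans (cong (_∸ k) N+d≡k+[1+k]) (ℕP.m+n∸m≡n k (suc k))

cOdd≡ballot : ∀ j t → cOdd j t ≡ ballot (2 ℕ.* t) (j ℕ.+ t)
cOdd≡ballot j t = coeff-binomial-⊛-oneMinusXPow (2 ℕ.* t) (2 ℕ.* j ℕ.+ 1) (j ℕ.+ t) (degrees j t)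
  where
  degrees : ∀ j t → 2 ℕ.* t ℕ.+ (2 ℕ.* j ℕ.+ 1) ≡ j ℕ.+ t ℕ.+ suc (j ℕ.+ t)
  degrees = ℕSolver.solve-∀

cEven≡ballot : ∀ j t → cEven j t ≡ ballot (2 ℕ.* t ℕ.+ 1) (j ℕ.+ t)
cEven≡ballot j t = coeff-binomial-⊛-oneMinusXPow (2 ℕ.* t ℕ.+ 1) (2 ℕ.* j) (j ℕ.+ t) (degrees j t)
  where
  degrees : ∀ j t → 2 ℕ.* t ℕ.+ 1 ℕ.+ 2 ℕ.* j ≡ j ℕ.+ t ℕ.+ suc (j ℕ.+ t)
  degrees = ℕSolver.solve-∀

[1+k]*[1+n]C[1+k]≡[1+n]*nCk : ∀ n k → suc k ℕ.* (suc n C suc k) ≡ suc n ℕ.* (n C k)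
[1+k]*[1+n]C[1+k]≡[1+n]*nCk zero    zero    = refl
[1+k]*[1+n]C[1+k]≡[1+n]*nCk zero    (suc k) = ℕP.*-zeroʳ (suc (suc k))
[1+k]*[1+n]C[1+k]≡[1+n]*nCk (suc n) zero    =
  trans (ℕP.*-identityˡ _) (trans (nC1≡n (suc (suc n))) (sym (ℕP.*-identityʳ (suc (suc n)))))
[1+k]*[1+n]C[1+k]≡[1+n]*nCk (suc n) (suc k) = begin
  suc (suc k) ℕ.* (suc (suc n) C suc (suc k))
    ≡⟨ cong (suc (suc k) ℕ.*_) (sym (nCk+nC[k+1]≡[n+1]C[k+1] (suc n) (suc k))) ⟩
  suc (suc k) ℕ.* (a ℕ.+ b)
    ≡⟨ split k a b ⟩
  suc k ℕ.* a ℕ.+ a ℕ.+ suc (suc k) ℕ.* b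
    ≡⟨ cong₂ (λ x y → x ℕ.+ a ℕ.+ y)
             ([1+k]*[1+n]C[1+k]≡[1+n]*nCk n k) ([1+k]*[1+n]C[1+k]≡[1+n]*nCk n (suc k)) ⟩
  suc n ℕ.* (n C k) ℕ.+ a ℕ.+ suc n ℕ.* (n C suc k)
    ≡⟨ merge n (n C k) (n C suc k) a ⟩
  suc n ℕ.* (n C k ℕ.+ n C suc k) ℕ.+ a
    ≡⟨ cong (λ x → suc n ℕ.* x ℕ.+ a) (nCk+nC[k+1]≡[n+1]C[k+1] n k) ⟩
  suc n ℕ.* a ℕ.+ a
    ≡⟨ ℕP.+-comm (suc n ℕ.* a) a ⟩
  suc (suc n) ℕ.* a
    ∎
  where
  open ≡-Reasoning
  a = suc n C suc k
  b = suc n C suc (suc k)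
  split : ∀ k a b → suc (suc k) ℕ.* (a ℕ.+ b) ≡ suc k ℕ.* a ℕ.+ a ℕ.+ suc (suc k) ℕ.* b
  split = ℕSolver.solve-∀
  merge : ∀ n u v a → suc n ℕ.* u ℕ.+ a ℕ.+ suc n ℕ.* v ≡ suc n ℕ.* (u ℕ.+ v) ℕ.+ a
  merge = ℕSolver.solve-∀

central-binomial-symmetry : ∀ k → (k ℕ.+ suc k) C k ≡ (k ℕ.+ suc k) C suc k
central-binomial-symmetry k =
  trans (nCk≡nC[n∸k] (ℕP.m≤m+n k (suc k))) (cong ((k ℕ.+ suc k) C_) (ℕP.m+n∸m≡n k (suc k)))

ballot-central-odd : ∀ k → ballot (k ℕ.+ suc k) k ≡ + 0
ballot-central-odd k =
  trans (cong (λ x → + x - + ((k ℕ.+ suc k) C suc k)) (central-binomial-symmetry k))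
        (ℤP.+-inverseʳ (+ ((k ℕ.+ suc k) C suc k)))

[1+t]*2tC[1+t]≡t*2tCt : ∀ t → suc t ℕ.* ((2 ℕ.* t) C suc t) ≡ t ℕ.* ((2 ℕ.* t) C t)
[1+t]*2tC[1+t]≡t*2tCt zero    = refl
[1+t]*2tC[1+t]≡t*2tCt (suc s) = subst (λ N → suc (suc s) ℕ.* (N C suc (suc s)) ≡ suc s ℕ.* (N C suc s))
  (sym (2*[1+s]≡1+s+[1+s] s)) (begin
    suc (suc s) ℕ.* (suc n C suc (suc s)) ≡⟨ [1+k]*[1+n]C[1+k]≡[1+n]*nCk n (suc s) ⟩
    suc n ℕ.* (n C suc s)                 ≡⟨ cong (suc n ℕ.*_) (sym (central-binomial-symmetry s)) ⟩
    suc n ℕ.* (n C s)                     ≡⟨ sym ([1+k]*[1+n]C[1+k]≡[1+n]*nCk n s) ⟩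
    suc s ℕ.* (suc n C suc s)             ∎)
  where
  open ≡-Reasoning
  n = s ℕ.+ suc s
  2*[1+s]≡1+s+[1+s] : ∀ s → 2 ℕ.* suc s ≡ suc (s ℕ.+ suc s)
  2*[1+s]≡1+s+[1+s] = ℕSolver.solve-∀

[1+t]*y≡t*x⇒x/[1+t]≡x-y : ∀ t x y → suc t ℕ.* y ≡ t ℕ.* x → + (x / suc t) ≡ + x - + y
[1+t]*y≡t*x⇒x/[1+t]≡x-y t x y eq =
  trans (cong +_ x/[1+t]≡x∸y) (sym (trans (ℤP.m-n≡m⊖n x y) (ℤP.⊖-≥ y≤x)))
  where
  open ≡-Reasoning
  y≤x : y ≤ x
  y≤x = ℕP.*-cancelˡ-≤ (suc t) (subst (ℕ._≤ suc t ℕ.* x) (sym eq) (ℕP.m≤n+m (t ℕ.* x) x))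
  [x∸y]*[1+t]≡x : (x ∸ y) ℕ.* suc t ≡ x
  [x∸y]*[1+t]≡x = begin
    (x ∸ y) ℕ.* suc t         ≡⟨ ℕP.*-distribʳ-∸ (suc t) x y ⟩
    x ℕ.* suc t ∸ y ℕ.* suc t ≡⟨ cong₂ _∸_ (ℕP.*-comm x (suc t)) (trans (ℕP.*-comm y (suc t)) eq) ⟩
    x ℕ.+ t ℕ.* x ∸ t ℕ.* x   ≡⟨ ℕP.m+n∸n≡m x (t ℕ.* x) ⟩
    x                         ∎
  x/[1+t]≡x∸y : x / suc t ≡ x ∸ y
  x/[1+t]≡x∸y = trans (cong (_/ suc t) (sym [x∸y]*[1+t]≡x)) (m*n/n≡m (x ∸ y) (suc t))

ballot-central-even : ∀ t → ballot (2 ℕ.* t) t ≡ + catalan t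
ballot-central-even t = sym ([1+t]*y≡t*x⇒x/[1+t]≡x-y t _ _ ([1+t]*2tC[1+t]≡t*2tCt t))

cOdd-zero : ∀ t → cOdd 0 t ≡ + catalan t
cOdd-zero t = trans (cOdd≡ballot 0 t) (ballot-central-even t)

cEven-zero : ∀ t → cEven 0 t ≡ + 0
cEven-zero t =
  trans (cEven≡ballot 0 t) (trans (cong (λ n → ballot n t) (2t+1≡t+[1+t] t)) (ballot-central-odd t))
  where
  2t+1≡t+[1+t] : ∀ t → 2 ℕ.* t ℕ.+ 1 ≡ t ℕ.+ suc t
  2t+1≡t+[1+t] = ℕSolver.solve-∀

cOdd-suc : ∀ j t → cOdd j (suc t) ≡ cEven (suc j) t + cEven j t
cOdd-suc j t = begin
  cOdd j (suc t)
    ≡⟨ cOdd≡ballot j (suc t) ⟩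
  ballot (2 ℕ.* suc t) (j ℕ.+ suc t)
    ≡⟨ cong₂ ballot (2[1+t]≡1+[2t+1] t) (ℕP.+-suc j t) ⟩
  ballot (suc (2 ℕ.* t ℕ.+ 1)) (suc (j ℕ.+ t))
    ≡⟨ ballot-pascal (2 ℕ.* t ℕ.+ 1) (j ℕ.+ t) ⟩
  ballot (2 ℕ.* t ℕ.+ 1) (suc j ℕ.+ t) + ballot (2 ℕ.* t ℕ.+ 1) (j ℕ.+ t)
    ≡⟨ sym (cong₂ _+_ (cEven≡ballot (suc j) t) (cEven≡ballot j t)) ⟩
  cEven (suc j) t + cEven j t
    ∎
  where
  open ≡-Reasoning
  2[1+t]≡1+[2t+1] : ∀ t → 2 ℕ.* suc t ≡ suc (2 ℕ.* t ℕ.+ 1)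
  2[1+t]≡1+[2t+1] = ℕSolver.solve-∀

cEven-suc : ∀ j t → cEven (suc j) t ≡ cOdd (suc j) t + cOdd j t
cEven-suc j t = begin
  cEven (suc j) t
    ≡⟨ cEven≡ballot (suc j) t ⟩
  ballot (2 ℕ.* t ℕ.+ 1) (suc (j ℕ.+ t))
    ≡⟨ cong (λ n → ballot n (suc (j ℕ.+ t))) (ℕP.+-comm (2 ℕ.* t) 1) ⟩
  ballot (suc (2 ℕ.* t)) (suc (j ℕ.+ t))
    ≡⟨ ballot-pascal (2 ℕ.* t) (j ℕ.+ t) ⟩
  ballot (2 ℕ.* t) (suc j ℕ.+ t) + ballot (2 ℕ.* t) (j ℕ.+ t)
    ≡⟨ sym (cong₂ _+_ (cOdd≡ballot (suc j) t) (cOdd≡ballot j t)) ⟩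
  cOdd (suc j) t + cOdd j t
    ∎
  where open ≡-Reasoning

Σ<-suc : ∀ n f → Σ< (suc n) f ≡ f 0 + Σ< n (f ∘ suc)
Σ<-suc n f = trans (cong (foldr _+_ (+ 0)) (map-upTo f (suc n)))
  (cong (λ s → f 0 + s) (sym (cong (foldr _+_ (+ 0)) (map-upTo (f ∘ suc) n))))

Σ<-cong : ∀ n {f g : ℕ → ℤ} → (∀ i → i < n → f i ≡ g i) → Σ< n f ≡ Σ< n g
Σ<-cong zero    f≗g = refl
Σ<-cong (suc n) {f} {g} f≗g = begin
  Σ< (suc n) f
    ≡⟨ Σ<-suc n f ⟩
  f 0 + Σ< n (f ∘ suc)
    ≡⟨ cong₂ _+_ (f≗g 0 (s≤s z≤n)) (Σ<-cong n (λ i i<n → f≗g (suc i) (s≤s i<n))) ⟩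
  g 0 + Σ< n (g ∘ suc)
    ≡⟨ sym (Σ<-suc n g) ⟩
  Σ< (suc n) g
    ∎
  where open ≡-Reasoning

Σ<-neg : ∀ n f → Σ< n (λ i → - f i) ≡ - Σ< n f
Σ<-neg zero    f = refl
Σ<-neg (suc n) f = begin
  Σ< (suc n) (λ i → - f i)         ≡⟨ Σ<-suc n (λ i → - f i) ⟩
  - f 0 + Σ< n (λ i → - f (suc i)) ≡⟨ cong (λ s → - f 0 + s) (Σ<-neg n (f ∘ suc)) ⟩
  - f 0 + - Σ< n (f ∘ suc)         ≡⟨ sym (ℤP.neg-distrib-+ (f 0) _) ⟩
  - (f 0 + Σ< n (f ∘ suc))         ≡⟨ cong -_ (sym (Σ<-suc n f)) ⟩
  - Σ< (suc n) f                   ∎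
  where open ≡-Reasoning

Σ<-alternating-telescope : ∀ (F : ℕ → ℤ) n →
  Σ< n (λ i → sgn i * (F (n ∸ i) + F (n ∸ suc i))) ≡ F n - sgn n * F 0
Σ<-alternating-telescope F zero    = empty (F 0)
  where
  empty : ∀ x → + 0 ≡ x - + 1 * x
  empty = solve-∀
Σ<-alternating-telescope F (suc n) = begin
  Σ< (suc n) (λ i → sgn i * (F (suc n ∸ i) + F (suc n ∸ suc i)))
    ≡⟨ Σ<-suc n (λ i → sgn i * (F (suc n ∸ i) + F (suc n ∸ suc i))) ⟩
  sgn 0 * (F (suc n) + F n) + Σ< n (λ i → sgn (suc i) * G i)
    ≡⟨ cong (λ s → sgn 0 * (F (suc n) + F n) + s) (Σ<-cong n (λ i _ → flip (sgn i) (G i))) ⟩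
  sgn 0 * (F (suc n) + F n) + Σ< n (λ i → - (sgn i * G i))
    ≡⟨ cong (λ s → sgn 0 * (F (suc n) + F n) + s) (Σ<-neg n (λ i → sgn i * G i)) ⟩
  sgn 0 * (F (suc n) + F n) + - Σ< n (λ i → sgn i * G i)
    ≡⟨ cong (λ s → sgn 0 * (F (suc n) + F n) + - s) (Σ<-alternating-telescope F n) ⟩
  sgn 0 * (F (suc n) + F n) + - (F n - sgn n * F 0)
    ≡⟨ cancel (F (suc n)) (F n) (sgn n) (F 0) ⟩
  F (suc n) - sgn (suc n) * F 0
    ∎
  where
  open ≡-Reasoning
  G : ℕ → ℤ
  G i = F (n ∸ i) + F (n ∸ suc i)
  flip : ∀ s x → (- + 1) * s * x ≡ - (s * x)
  flip = solve-∀
  cancel : ∀ a b s x → + 1 * (a + b) + - (b - s * x) ≡ a - (- + 1) * s * x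
  cancel = solve-∀

cEven≡alternating-Σ-cOdd : ∀ n t → cEven (suc n) t ≡ Σ< (suc n) (λ i → sgn i * cOdd (n ∸ i) (suc t))
cEven≡alternating-Σ-cOdd n t = sym (begin
  Σ< (suc n) (λ i → sgn i * cOdd (n ∸ i) (suc t))
    ≡⟨ Σ<-cong (suc n) (λ i i≤n → cong (sgn i *_) (split i i≤n)) ⟩
  Σ< (suc n) (λ i → sgn i * (F (suc n ∸ i) + F (suc n ∸ suc i)))
    ≡⟨ Σ<-alternating-telescope F (suc n) ⟩
  F (suc n) - sgn (suc n) * F 0
    ≡⟨ cong (λ x → F (suc n) - sgn (suc n) * x) (cEven-zero t) ⟩
  F (suc n) - sgn (suc n) * + 0
    ≡⟨ cong (λ x → F (suc n) - x) (ℤP.*-zeroʳ (sgn (suc n))) ⟩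
  F (suc n) - + 0
    ≡⟨ ℤP.+-identityʳ (F (suc n)) ⟩
  F (suc n)
    ∎)
  where
  open ≡-Reasoning
  F : ℕ → ℤ
  F j = cEven j t
  split : ∀ i → i < suc n → cOdd (n ∸ i) (suc t) ≡ F (suc n ∸ i) + F (n ∸ i)
  split i (s≤s i≤n) =
    trans (cOdd-suc (n ∸ i) t) (cong (λ j → F j + F (n ∸ i)) (sym (ℕP.+-∸-assoc 1 i≤n)))

cOdd≡catalan+alternating-Σ-cEven : ∀ n t →
  cOdd n t ≡ sgn n * + catalan t + Σ< n (λ i → sgn i * cEven (n ∸ i) t)
cOdd≡catalan+alternating-Σ-cEven n t = begin
  F n
    ≡⟨ rearrange (F n) (sgn n * F 0) ⟩
  sgn n * F 0 + (F n - sgn n * F 0)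
    ≡⟨ cong₂ (λ x y → sgn n * x + y) (cOdd-zero t) (sym (Σ<-alternating-telescope F n)) ⟩
  sgn n * + catalan t + Σ< n (λ i → sgn i * (F (n ∸ i) + F (n ∸ suc i)))
    ≡⟨ cong (λ s → sgn n * + catalan t + s)
           (Σ<-cong n (λ i i<n → cong (sgn i *_) (sym (split i i<n)))) ⟩
  sgn n * + catalan t + Σ< n (λ i → sgn i * cEven (n ∸ i) t)
    ∎
  where
  open ≡-Reasoning
  F : ℕ → ℤ
  F j = cOdd j t
  rearrange : ∀ x y → x ≡ y + (x - y)
  rearrange = solve-∀
  split : ∀ i → i < n → cEven (n ∸ i) t ≡ F (n ∸ i) + F (n ∸ suc i)
  split i i<n = trans (cong (λ j → cEven j t) n∸i≡1+[n∸1+i]) (trans (cEven-suc (n ∸ suc i) t)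
    (cong (λ j → F j + F (n ∸ suc i)) (sym n∸i≡1+[n∸1+i])))
    where
    n∸i≡1+[n∸1+i] : n ∸ i ≡ suc (n ∸ suc i)
    n∸i≡1+[n∸1+i] = ℕP.+-∸-assoc 1 i<n

isOdd[j+j]≡false : ∀ j → isOdd (j ℕ.+ j) ≡ false
isOdd[j+j]≡false zero    = refl
isOdd[j+j]≡false (suc j) rewrite ℕP.+-suc j j = isOdd[j+j]≡false j

isOdd[1+j+j]≡true : ∀ j → isOdd (suc (j ℕ.+ j)) ≡ true
isOdd[1+j+j]≡true zero    = refl
isOdd[1+j+j]≡true (suc j) rewrite ℕP.+-suc j j = isOdd[1+j+j]≡true j

⌊[j+j]/2⌋≡j : ∀ j → ⌊ j ℕ.+ j /2⌋ ≡ j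
⌊[j+j]/2⌋≡j zero    = refl
⌊[j+j]/2⌋≡j (suc j) rewrite ℕP.+-suc j j = cong suc (⌊[j+j]/2⌋≡j j)

⌊[1+j+j]/2⌋≡j : ∀ j → ⌊ suc (j ℕ.+ j) /2⌋ ≡ j
⌊[1+j+j]/2⌋≡j zero    = refl
⌊[1+j+j]/2⌋≡j (suc j) rewrite ℕP.+-suc j j = cong suc (⌊[1+j+j]/2⌋≡j j)

2*j≡j+j : ∀ j → 2 ℕ.* j ≡ j ℕ.+ j
2*j≡j+j j = cong (j ℕ.+_) (ℕP.+-identityʳ j)

c-even : ∀ j t → c (2 ℕ.* j) t ≡ cEven j t
c-even j t = trans (cong (λ m → c m t) (2*j≡j+j j)) c-double
  where
  c-double : c (j ℕ.+ j) t ≡ cEven j t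
  c-double rewrite isOdd[j+j]≡false j | ⌊[j+j]/2⌋≡j j = refl

c-odd : ∀ j t → c (2 ℕ.* j ℕ.+ 1) t ≡ cOdd j t
c-odd j t =
  trans (cong (λ m → c m t) (trans (ℕP.+-comm (2 ℕ.* j) 1) (cong suc (2*j≡j+j j)))) c-suc-double
  where
  c-suc-double : c (suc (j ℕ.+ j)) t ≡ cOdd j t
  c-suc-double rewrite isOdd[1+j+j]≡true j | ⌊[1+j+j]/2⌋≡j j = refl

c-odd-∸ : ∀ m i t → i ≤ m → c (2 ℕ.* m ℕ.+ 1 ∸ 2 ℕ.* i) t ≡ cOdd (m ∸ i) t
c-odd-∸ m i t i≤m = trans (cong (λ n → c n t) 2m+1∸2i≡2[m∸i]+1) (c-odd (m ∸ i) t)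
  where
  2m+1∸2i≡2[m∸i]+1 : 2 ℕ.* m ℕ.+ 1 ∸ 2 ℕ.* i ≡ 2 ℕ.* (m ∸ i) ℕ.+ 1
  2m+1∸2i≡2[m∸i]+1 =
    trans (ℕP.+-∸-comm 1 (ℕP.*-monoʳ-≤ 2 i≤m)) (cong (ℕ._+ 1) (sym (ℕP.*-distribˡ-∸ 2 m i)))

c-even-∸ : ∀ m i t → c (2 ℕ.* m ∸ 2 ℕ.* i) t ≡ cEven (m ∸ i) t
c-even-∸ m i t = trans (cong (λ n → c n t) (sym (ℕP.*-distribˡ-∸ 2 m i))) (c-even (m ∸ i) t)

corollary8p12 : ((m′ t : ℕ) → 1 ≤ t →
    let m = 2 ℕ.* m′ ℕ.+ 1 in
    c (m ℕ.+ 1) t ≡ Σ< (suc m′) (λ i → sgn i ℤ.* c (m ∸ 2 ℕ.* i) (t ℕ.+ 1)))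
    ×
    ((m′ t : ℕ) → 1 ≤ m′ → 1 ≤ t →
    let m = 2 ℕ.* m′ in
    c (m ℕ.+ 1) t ≡ sgn m′ ℤ.* + catalan t ℤ.+ Σ< m′ (λ i → sgn i ℤ.* c (m ∸ 2 ℕ.* i) t))
corollary8p12 = part-a , part-b
  where
  open ≡-Reasoning
  2m+1+1≡2[1+m] : ∀ m → 2 ℕ.* m ℕ.+ 1 ℕ.+ 1 ≡ 2 ℕ.* suc m
  2m+1+1≡2[1+m] = ℕSolver.solve-∀
  -- Neither identity needs the lower bounds on m′ and t.
  part-a : (m′ t : ℕ) → 1 ≤ t →
    c (2 ℕ.* m′ ℕ.+ 1 ℕ.+ 1) t ≡ Σ< (suc m′) (λ i → sgn i * c (2 ℕ.* m′ ℕ.+ 1 ∸ 2 ℕ.* i) (t ℕ.+ 1))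
  part-a m′ t _ = begin
    c (2 ℕ.* m′ ℕ.+ 1 ℕ.+ 1) t ≡⟨ cong (λ m → c m t) (2m+1+1≡2[1+m] m′) ⟩
    c (2 ℕ.* suc m′) t         ≡⟨ c-even (suc m′) t ⟩
    cEven (suc m′) t           ≡⟨ cEven≡alternating-Σ-cOdd m′ t ⟩
    Σ< (suc m′) (λ i → sgn i * cOdd (m′ ∸ i) (suc t))
      ≡⟨ Σ<-cong (suc m′) (λ { i (s≤s i≤m′) → cong (sgn i *_)
           (sym (trans (cong (c _) (ℕP.+-comm t 1)) (c-odd-∸ m′ i (suc t) i≤m′))) }) ⟩
    Σ< (suc m′) (λ i → sgn i * c (2 ℕ.* m′ ℕ.+ 1 ∸ 2 ℕ.* i) (t ℕ.+ 1)) ∎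
  part-b : (m′ t : ℕ) → 1 ≤ m′ → 1 ≤ t →
    c (2 ℕ.* m′ ℕ.+ 1) t ≡ sgn m′ * + catalan t + Σ< m′ (λ i → sgn i * c (2 ℕ.* m′ ∸ 2 ℕ.* i) t)
  part-b m′ t _ _ = begin
    c (2 ℕ.* m′ ℕ.+ 1) t ≡⟨ c-odd m′ t ⟩
    cOdd m′ t            ≡⟨ cOdd≡catalan+alternating-Σ-cEven m′ t ⟩
    sgn m′ * + catalan t + Σ< m′ (λ i → sgn i * cEven (m′ ∸ i) t)
      ≡⟨ cong (λ s → sgn m′ * + catalan t + s)
           (Σ<-cong m′ (λ i _ → cong (sgn i *_) (sym (c-even-∸ m′ i t)))) ⟩
    sgn m′ * + catalan t + Σ< m′ (λ i → sgn i * c (2 ℕ.* m′ ∸ 2 ℕ.* i) t) ∎
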